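{- Let $\Gamma$ be a directed strongly regular graph with parameters $(v,k,t,\lambda,\mu)$ and let $G$ be a group of automorphisms of $\Gamma$. Let $O_1,O_2,\ldots,O_b$ be the $G$-orbits on the vertex set of $\Gamma$, with $|O_i|=n_i$ for $i=1,\ldots,b$. Let $R=[r_{ij}]$ be the $b\times b$ row orbit matrix of $\Gamma$ with respect to $G$, i.e. $r_{ij}$ is the number of vertices $y\in O_j$ such that there is an arc $x\to y$, for any (equivalently, every) vertex $x\in O_i$. Then: (1) $0\le r_{ij}\le n_j$ for all $1\le i,j\le b$; (2) $0\le r_{ii}\le n_i-1$ for all $1\le i\le b$; (3) $\sum_{j=1}^b r_{ij}=k$ for all $1\le i\le b$; (4) $\sum_{s=1}^b r_{is}r_{sj}=\delta_{ij}(t-\mu)+r_{ij}\lambda+(n_j-r_{ij})\mu$ for all $1\le i,j\le b$, where $\delta_{ij}$ is the Kronecker delta.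
   Context: A directed graph is $k$-regular if every vertex has out-degree and in-degree $k$; it is simple if it has no loops and no multiple arcs with the same source and target. A directed strongly regular graph with parameters $(v,k,t,\lambda,\mu)$ is a simple $k$-regular directed graph on $v$ vertices such that the number of directed paths of length 2 from a vertex $x$ to a vertex $y$ equals $t$ if $x=y$, equals $\lambda$ if there is an arc $x\to y$, and equals $\mu$ if $x\ne y$ and there is no arc $x\to y$. An automorphism is a bijection of the vertex set preserving arcs in both directions. Since $G$ acts by automorphisms, the number of out-neighbours in $O_j$ of a vertex $x\in O_i$ does not depend on the choice of $x\in O_i$. -}

module Defs where

open import Level using (Level)
open import Data.Nat using (ℕ; zero; suc; _+_)
open import Data.Bool using (Bool; true; false; _∧_)
open import Data.Fin using (Fin; zero; suc)
open import Data.Fin.Properties using () renaming (_≟_ to _≟ᶠ_)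
open import Data.Product using (∃; Σ; _×_)
open import Relation.Nullary.Decidable using (⌊_⌋)
open import Relation.Nullary using (yes; no)
open import Relation.Binary.PropositionalEquality using (_≡_; _≢_)
open import Algebra.Bundles using (Group)
open import Function.Bundles using (_⇔_)
open import Data.Integer using (ℤ; +_; _-_)

∑ : ∀ {n} → (Fin n → ℕ) → ℕ
∑ {zero} f = 0
∑ {suc n} f = f zero + ∑ (λ i → f (suc i))

count : ∀ {n} → (Fin n → Bool) → ℕ
count {zero} p = 0
count {suc n} p = (if0 (p zero)) + count (λ i → p (suc i))
  where
  if0 : Bool → ℕ
  if0 true = 1
  if0 false = 0

δ : ∀ {b} → Fin b → Fin b → ℤ
δ i j with i ≟ᶠ j
... | yes _ = + 1
... | no _ = + 0

-- A directed graph on vertex set Fin v, given by its arc relation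
-- (A x y ≡ true iff there is an arc x → y). Multiple arcs cannot occur.
Digraph : ℕ → Set
Digraph v = Fin v → Fin v → Bool

paths2 : ∀ {v} → Digraph v → Fin v → Fin v → ℕ
paths2 A x y = count (λ z → A x z ∧ A z y)

record IsDSRG (v k t lam mu : ℕ) (A : Digraph v) : Set where
  field
    noLoops   : ∀ x → A x x ≡ false
    outDegree : ∀ x → count (λ y → A x y) ≡ k
    inDegree  : ∀ y → count (λ x → A x y) ≡ k
    pathsSame : ∀ x → paths2 A x x ≡ t
    pathsArc  : ∀ x y → x ≢ y → A x y ≡ true → paths2 A x y ≡ lam
    pathsNon  : ∀ x y → x ≢ y → A x y ≡ false → paths2 A x y ≡ mu

record IsAutAction {c ℓ : Level} {v : ℕ} (A : Digraph v) (G : Group c ℓ)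
                   (act : Group.Carrier G → Fin v → Fin v) : Set (c Level.⊔ ℓ) where
  open Group G
  field
    act-cong : ∀ {g h} → g ≈ h → ∀ x → act g x ≡ act h x
    act-id   : ∀ x → act ε x ≡ x
    act-hom  : ∀ g h x → act (g ∙ h) x ≡ act g (act h x)
    act-aut  : ∀ g x y → A (act g x) (act g y) ≡ A x y

record IsOrbitLabelling {c ℓ : Level} {v : ℕ} (G : Group c ℓ)
                        (act : Group.Carrier G → Fin v → Fin v)
                        (b : ℕ) (orb : Fin v → Fin b) : Set (c Level.⊔ ℓ) where
  field
    sameOrbit : ∀ x y → (orb x ≡ orb y) ⇔ (∃ λ g → act g x ≡ y)
    surjective : ∀ i → ∃ λ x → orb x ≡ i

orbitSize : ∀ {v b} → (Fin v → Fin b) → Fin b → ℕ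
orbitSize orb i = count (λ x → ⌊ orb x ≟ᶠ i ⌋)

-- Row orbit matrix entry r_ij, computed using a representative rep i ∈ O_i:
-- number of y ∈ O_j with an arc rep i → y.
rowOrbitMatrix : ∀ {v b} → Digraph v → (Fin v → Fin b) → (Fin b → Fin v)
                 → Fin b → Fin b → ℕ
rowOrbitMatrix A orb rep i j = count (λ y → A (rep i) y ∧ ⌊ orb y ≟ᶠ j ⌋)

-- Write a x y = [x → y] and I y j = [y ∈ O j].  Then r i j = Σ_y a x y · I y j for x = rep i,
-- and since G permutes the vertices of each orbit and preserves arcs, the same sum taken at any
-- vertex z equals r (orb z) j.  Hence Σ_s r i s · r s j = Σ_z a x z · r (orb z) j
-- = Σ_y (A²) x y · I y j, and multiplying the DSRG identity A² + μI + μA = tI + λA + μJ by I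
-- and reading it at row x gives (4).
module Submission where

open import Defs
open import Level using (Level)
open import Data.Bool using (Bool; true; false; _∧_)
open import Data.Bool.Properties using (∧-conicalʳ)
open import Data.Nat using (ℕ; zero; suc; _≤_; _<_; _∸_; z≤n) renaming (_+_ to _+ℕ_; _*_ to _*ℕ_)
import Data.Nat.Properties as ℕ
open import Data.Nat.Tactic.RingSolver using (solve-∀; solve)
open import Data.List using ([]; _∷_)
open import Data.Fin using (Fin; punchIn)
open import Data.Fin.Properties using (punchInᵢ≢i) renaming (_≟_ to _≟ᶠ_)
open import Data.Fin.Permutation using (permutation)
open import Data.Integer using (+_; _+_; _-_; _*_)
import Data.Integer.Properties as ℤ
import Data.Integer.Tactic.RingSolver as ℤ-Solver
open import Data.Product using (_×_; _,_)
open import Algebra.Bundles using (Group)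
open import Algebra.Properties.Semiring.Sum ℕ.+-*-semiring
  using (sum; sum-cong-≗; sum-replicate-zero; sum-remove; ∑-distrib-+; ∑-comm;
         *-distribˡ-sum; *-distribʳ-sum; sum-permute)
open import Function using (_∘_)
open import Function.Bundles using (Equivalence)
open import Relation.Nullary using (Dec; ¬_; yes; no)
open import Relation.Nullary.Decidable using (⌊_⌋; isYes≗does; dec-true; dec-false)
open import Relation.Binary.PropositionalEquality
  using (_≡_; refl; sym; trans; cong; cong₂; subst; subst₂; module ≡-Reasoning)

open ≡-Reasoning

𝟙 : Bool → ℕ
𝟙 true = 1
𝟙 false = 0

𝟙-∧ : ∀ a b → 𝟙 (a ∧ b) ≡ 𝟙 a *ℕ 𝟙 b
𝟙-∧ true b = sym (ℕ.+-identityʳ (𝟙 b))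
𝟙-∧ false b = refl

𝟙-mono : ∀ {a b} → (a ≡ true → b ≡ true) → 𝟙 a ≤ 𝟙 b
𝟙-mono {false} a⇒b = z≤n
𝟙-mono {true} a⇒b rewrite a⇒b refl = ℕ.≤-refl

⌊⌋-yes : ∀ {a} {A : Set a} (a? : Dec A) → A → ⌊ a? ⌋ ≡ true
⌊⌋-yes a? a = trans (isYes≗does a?) (dec-true a? a)

⌊⌋-no : ∀ {a} {A : Set a} (a? : Dec A) → ¬ A → ⌊ a? ⌋ ≡ false
⌊⌋-no a? ¬a = trans (isYes≗does a?) (dec-false a? ¬a)

∑≡sum : ∀ {n} (f : Fin n → ℕ) → ∑ f ≡ sum f
∑≡sum {zero} f = refl
∑≡sum {suc n} f = cong (f Fin.zero +ℕ_) (∑≡sum (f ∘ Fin.suc))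

count≡sum : ∀ {n} (p : Fin n → Bool) → count p ≡ sum (𝟙 ∘ p)
count≡sum {zero} p = refl
count≡sum {suc n} p with p Fin.zero
... | true = cong suc (count≡sum (p ∘ Fin.suc))
... | false = count≡sum (p ∘ Fin.suc)

sum-mono-≤ : ∀ {n} {f g : Fin n → ℕ} → (∀ i → f i ≤ g i) → sum f ≤ sum g
sum-mono-≤ {zero} f≤g = z≤n
sum-mono-≤ {suc n} f≤g = ℕ.+-mono-≤ (f≤g Fin.zero) (sum-mono-≤ (f≤g ∘ Fin.suc))

sum-mono-< : ∀ {n} {f g : Fin (suc n) → ℕ} → (∀ i → f i ≤ g i) → ∀ c → f c < g c → sum f < sum g
sum-mono-< {f = f} {g} f≤g c fc<gc = subst₂ _<_ (sym (sum-remove {i = c} f)) (sym (sum-remove {i = c} g))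
  (ℕ.+-mono-<-≤ fc<gc (sum-mono-≤ (f≤g ∘ punchIn c)))

sum-indicator : ∀ {n} (c : Fin n) (f : Fin n → ℕ) → sum (λ i → 𝟙 ⌊ c ≟ᶠ i ⌋ *ℕ f i) ≡ f c
sum-indicator {suc n} c f = begin
  sum (λ i → 𝟙 ⌊ c ≟ᶠ i ⌋ *ℕ f i)
    ≡⟨ sum-remove {i = c} (λ i → 𝟙 ⌊ c ≟ᶠ i ⌋ *ℕ f i) ⟩
  𝟙 ⌊ c ≟ᶠ c ⌋ *ℕ f c +ℕ sum (λ j → 𝟙 ⌊ c ≟ᶠ punchIn c j ⌋ *ℕ f (punchIn c j))
    ≡⟨ cong₂ _+ℕ_ (cong (λ a → 𝟙 a *ℕ f c) (⌊⌋-yes (c ≟ᶠ c) refl))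
                  (sum-cong-≗ (λ j → cong (λ a → 𝟙 a *ℕ f (punchIn c j))
                                          (⌊⌋-no (c ≟ᶠ punchIn c j) (punchInᵢ≢i c j ∘ sym)))) ⟩
  1 *ℕ f c +ℕ sum {n} (λ j → 0)
    ≡⟨ cong₂ _+ℕ_ (ℕ.*-identityˡ (f c)) (sum-replicate-zero n) ⟩
  f c +ℕ 0
    ≡⟨ ℕ.+-identityʳ (f c) ⟩
  f c ∎

sum-*-assoc : ∀ {m n} (f : Fin m → ℕ) (g : Fin m → Fin n → ℕ) (h : Fin n → ℕ) →
  sum (λ z → f z *ℕ sum (λ y → g z y *ℕ h y)) ≡ sum (λ y → sum (λ z → f z *ℕ g z y) *ℕ h y)
sum-*-assoc f g h = begin
  sum (λ z → f z *ℕ sum (λ y → g z y *ℕ h y))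
    ≡⟨ sum-cong-≗ (λ z → *-distribˡ-sum (f z) (λ y → g z y *ℕ h y)) ⟩
  sum (λ z → sum (λ y → f z *ℕ (g z y *ℕ h y)))
    ≡⟨ ∑-comm (λ z y → f z *ℕ (g z y *ℕ h y)) ⟩
  sum (λ y → sum (λ z → f z *ℕ (g z y *ℕ h y)))
    ≡⟨ sum-cong-≗ (λ y → trans (sum-cong-≗ (λ z → sym (ℕ.*-assoc (f z) (g z y) (h y))))
                                (sym (*-distribʳ-sum (h y) (λ z → f z *ℕ g z y)))) ⟩
  sum (λ y → sum (λ z → f z *ℕ g z y) *ℕ h y) ∎

sum-linear₃ : ∀ {n} (f g h : Fin n → ℕ) α β γ →
  sum (λ i → f i *ℕ α +ℕ g i *ℕ β +ℕ h i *ℕ γ) ≡ sum f *ℕ α +ℕ sum g *ℕ β +ℕ sum h *ℕ γ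
sum-linear₃ f g h α β γ = begin
  sum (λ i → f i *ℕ α +ℕ g i *ℕ β +ℕ h i *ℕ γ)
    ≡⟨ ∑-distrib-+ (λ i → f i *ℕ α +ℕ g i *ℕ β) (λ i → h i *ℕ γ) ⟩
  sum (λ i → f i *ℕ α +ℕ g i *ℕ β) +ℕ sum (λ i → h i *ℕ γ)
    ≡⟨ cong (_+ℕ sum (λ i → h i *ℕ γ)) (∑-distrib-+ (λ i → f i *ℕ α) (λ i → g i *ℕ β)) ⟩
  sum (λ i → f i *ℕ α) +ℕ sum (λ i → g i *ℕ β) +ℕ sum (λ i → h i *ℕ γ)
    ≡⟨ sym (cong₂ _+ℕ_ (cong₂ _+ℕ_ (*-distribʳ-sum α f) (*-distribʳ-sum β g)) (*-distribʳ-sum γ h)) ⟩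
  sum f *ℕ α +ℕ sum g *ℕ β +ℕ sum h *ℕ γ ∎

sum-weighted-identity : ∀ {n} (P D a : Fin n → ℕ) t lam mu →
  (∀ y → P y +ℕ D y *ℕ mu +ℕ a y *ℕ mu ≡ D y *ℕ t +ℕ a y *ℕ lam +ℕ mu) → ∀ (w : Fin n → ℕ) →
  sum (λ y → P y *ℕ w y) +ℕ sum (λ y → D y *ℕ w y) *ℕ mu +ℕ sum (λ y → a y *ℕ w y) *ℕ mu
    ≡ sum (λ y → D y *ℕ w y) *ℕ t +ℕ sum (λ y → a y *ℕ w y) *ℕ lam +ℕ sum w *ℕ mu
sum-weighted-identity P D a t lam mu pointwise w = begin
  sum Pw +ℕ sum Dw *ℕ mu +ℕ sum aw *ℕ mu
    ≡⟨ cong (λ s → s +ℕ sum Dw *ℕ mu +ℕ sum aw *ℕ mu) (sym (ℕ.*-identityʳ (sum Pw))) ⟩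
  sum Pw *ℕ 1 +ℕ sum Dw *ℕ mu +ℕ sum aw *ℕ mu
    ≡⟨ sym (sum-linear₃ Pw Dw aw 1 mu mu) ⟩
  sum (λ y → Pw y *ℕ 1 +ℕ Dw y *ℕ mu +ℕ aw y *ℕ mu)
    ≡⟨ sum-cong-≗ weighted ⟩
  sum (λ y → Dw y *ℕ t +ℕ aw y *ℕ lam +ℕ w y *ℕ mu)
    ≡⟨ sum-linear₃ Dw aw w t lam mu ⟩
  sum Dw *ℕ t +ℕ sum aw *ℕ lam +ℕ sum w *ℕ mu ∎
  where
  Pw Dw aw : Fin _ → ℕ
  Pw y = P y *ℕ w y
  Dw y = D y *ℕ w y
  aw y = a y *ℕ w y
  expandˡ : ∀ P D a w mu → (P *ℕ w) *ℕ 1 +ℕ (D *ℕ w) *ℕ mu +ℕ (a *ℕ w) *ℕ mu ≡ (P +ℕ D *ℕ mu +ℕ a *ℕ mu) *ℕ w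
  expandˡ = solve-∀
  expandʳ : ∀ D a w t lam mu → (D *ℕ t +ℕ a *ℕ lam +ℕ mu) *ℕ w ≡ (D *ℕ w) *ℕ t +ℕ (a *ℕ w) *ℕ lam +ℕ w *ℕ mu
  expandʳ = solve-∀
  weighted : ∀ y → Pw y *ℕ 1 +ℕ Dw y *ℕ mu +ℕ aw y *ℕ mu ≡ Dw y *ℕ t +ℕ aw y *ℕ lam +ℕ w y *ℕ mu
  weighted y = trans (expandˡ (P y) (D y) (a y) (w y) mu)
                     (trans (cong (_*ℕ w y) (pointwise y)) (expandʳ (D y) (a y) (w y) t lam mu))

count-cong : ∀ {n} {p q : Fin n → Bool} → (∀ x → p x ≡ q x) → count p ≡ count q
count-cong {p = p} {q} p≗q = trans (count≡sum p) (trans (sum-cong-≗ (cong 𝟙 ∘ p≗q)) (sym (count≡sum q)))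

count-mono : ∀ {n} {p q : Fin n → Bool} → (∀ x → p x ≡ true → q x ≡ true) → count p ≤ count q
count-mono {p = p} {q} p⇒q =
  subst₂ _≤_ (sym (count≡sum p)) (sym (count≡sum q)) (sum-mono-≤ (λ x → 𝟙-mono (p⇒q x)))

count-mono-< : ∀ {n} {p q : Fin n → Bool} → (∀ x → p x ≡ true → q x ≡ true) →
  ∀ c → p c ≡ false → q c ≡ true → count p < count q
count-mono-< {suc n} {p} {q} p⇒q c pc qc =
  subst₂ _<_ (sym (count≡sum p)) (sym (count≡sum q))
    (sum-mono-< (λ x → 𝟙-mono (p⇒q x)) c (subst₂ (λ a b → 𝟙 a < 𝟙 b) (sym pc) (sym qc) (ℕ.n<1+n 0)))

outNeighboursIn : ∀ {v b} → Digraph v → (Fin v → Fin b) → Fin v → Fin b → ℕ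
outNeighboursIn A lab x j = count (λ y → A x y ∧ ⌊ lab y ≟ᶠ j ⌋)

module _ {v b : ℕ} (A : Digraph v) (lab : Fin v → Fin b) where

  outNeighboursIn≡sum : ∀ x j → outNeighboursIn A lab x j ≡ sum (λ y → 𝟙 (A x y) *ℕ 𝟙 ⌊ lab y ≟ᶠ j ⌋)
  outNeighboursIn≡sum x j = trans (count≡sum (λ y → A x y ∧ ⌊ lab y ≟ᶠ j ⌋)) (sum-cong-≗ (λ y → 𝟙-∧ (A x y) _))

  sum-outNeighboursIn : ∀ x (h : Fin b → ℕ) →
    sum (λ j → outNeighboursIn A lab x j *ℕ h j) ≡ sum (λ y → 𝟙 (A x y) *ℕ h (lab y))
  sum-outNeighboursIn x h = begin
    sum (λ j → outNeighboursIn A lab x j *ℕ h j)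
      ≡⟨ sum-cong-≗ (λ j → cong (_*ℕ h j) (outNeighboursIn≡sum x j)) ⟩
    sum (λ j → sum (λ y → 𝟙 (A x y) *ℕ 𝟙 ⌊ lab y ≟ᶠ j ⌋) *ℕ h j)
      ≡⟨ sym (sum-*-assoc (𝟙 ∘ A x) (λ y j → 𝟙 ⌊ lab y ≟ᶠ j ⌋) h) ⟩
    sum (λ y → 𝟙 (A x y) *ℕ sum (λ j → 𝟙 ⌊ lab y ≟ᶠ j ⌋ *ℕ h j))
      ≡⟨ sum-cong-≗ (λ y → cong (𝟙 (A x y) *ℕ_) (sum-indicator (lab y) h)) ⟩
    sum (λ y → 𝟙 (A x y) *ℕ h (lab y)) ∎

  outNeighboursIn≤orbitSize : ∀ x j → outNeighboursIn A lab x j ≤ orbitSize lab j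
  outNeighboursIn≤orbitSize x j = count-mono (λ y → ∧-conicalʳ (A x y) _)

  outNeighboursIn-<-orbitSize : ∀ x → A x x ≡ false → outNeighboursIn A lab x (lab x) < orbitSize lab (lab x)
  outNeighboursIn-<-orbitSize x no-loop =
    count-mono-< (λ y → ∧-conicalʳ (A x y) _) x (cong (_∧ _) no-loop) (⌊⌋-yes (lab x ≟ᶠ lab x) refl)

  sum-outNeighboursIn≡outDegree : ∀ x → sum (λ j → outNeighboursIn A lab x j) ≡ count (A x)
  sum-outNeighboursIn≡outDegree x = begin
    sum (λ j → outNeighboursIn A lab x j)
      ≡⟨ sum-cong-≗ (λ j → sym (ℕ.*-identityʳ (outNeighboursIn A lab x j))) ⟩
    sum (λ j → outNeighboursIn A lab x j *ℕ 1)
      ≡⟨ sum-outNeighboursIn x (λ _ → 1) ⟩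
    sum (λ y → 𝟙 (A x y) *ℕ 1)
      ≡⟨ sum-cong-≗ (λ y → ℕ.*-identityʳ (𝟙 (A x y))) ⟩
    sum (𝟙 ∘ A x)
      ≡⟨ sym (count≡sum (A x)) ⟩
    count (A x) ∎

  sum-outNeighboursIn≡sum-paths2 : ∀ x j →
    sum (λ z → 𝟙 (A x z) *ℕ outNeighboursIn A lab z j) ≡ sum (λ y → paths2 A x y *ℕ 𝟙 ⌊ lab y ≟ᶠ j ⌋)
  sum-outNeighboursIn≡sum-paths2 x j = begin
    sum (λ z → 𝟙 (A x z) *ℕ outNeighboursIn A lab z j)
      ≡⟨ sum-cong-≗ (λ z → cong (𝟙 (A x z) *ℕ_) (outNeighboursIn≡sum z j)) ⟩
    sum (λ z → 𝟙 (A x z) *ℕ sum (λ y → 𝟙 (A z y) *ℕ 𝟙 ⌊ lab y ≟ᶠ j ⌋))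
      ≡⟨ sum-*-assoc (𝟙 ∘ A x) (λ z y → 𝟙 (A z y)) (λ y → 𝟙 ⌊ lab y ≟ᶠ j ⌋) ⟩
    sum (λ y → sum (λ z → 𝟙 (A x z) *ℕ 𝟙 (A z y)) *ℕ 𝟙 ⌊ lab y ≟ᶠ j ⌋)
      ≡⟨ sum-cong-≗ (λ y → cong (_*ℕ 𝟙 ⌊ lab y ≟ᶠ j ⌋) (sym paths2≡sum)) ⟩
    sum (λ y → paths2 A x y *ℕ 𝟙 ⌊ lab y ≟ᶠ j ⌋) ∎
    where
    paths2≡sum : ∀ {y} → paths2 A x y ≡ sum (λ z → 𝟙 (A x z) *ℕ 𝟙 (A z y))
    paths2≡sum {y} = trans (count≡sum (λ z → A x z ∧ A z y)) (sum-cong-≗ (λ z → 𝟙-∧ (A x z) (A z y)))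

module _ {c ℓ : Level} {v : ℕ} {A : Digraph v} {G : Group c ℓ} {act : Group.Carrier G → Fin v → Fin v}
         (aut : IsAutAction A G act) where

  open Group G using (_⁻¹; inverseˡ; inverseʳ)
  open IsAutAction aut

  act-inverseˡ : ∀ g y → act (g ⁻¹) (act g y) ≡ y
  act-inverseˡ g y = trans (sym (act-hom (g ⁻¹) g y)) (trans (act-cong (inverseˡ g) y) (act-id y))

  act-inverseʳ : ∀ g y → act g (act (g ⁻¹) y) ≡ y
  act-inverseʳ g y = trans (sym (act-hom g (g ⁻¹) y)) (trans (act-cong (inverseʳ g) y) (act-id y))

  count-act : ∀ g (p : Fin v → Bool) → count p ≡ count (p ∘ act g)
  count-act g p = begin
    count p                 ≡⟨ count≡sum p ⟩
    sum (𝟙 ∘ p)             ≡⟨ sum-permute (𝟙 ∘ p) (permutation (act g) (act (g ⁻¹)) (act-inverseʳ g) (act-inverseˡ g)) ⟩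
    sum (𝟙 ∘ p ∘ act g)     ≡⟨ sym (count≡sum (p ∘ act g)) ⟩
    count (p ∘ act g)       ∎

  module _ {b : ℕ} {orb : Fin v → Fin b} (orbits : IsOrbitLabelling G act b orb) where

    open IsOrbitLabelling orbits

    orb-act : ∀ g y → orb (act g y) ≡ orb y
    orb-act g y = sym (Equivalence.from (sameOrbit y (act g y)) (g , refl))

    outNeighboursIn-act : ∀ g x j → outNeighboursIn A orb (act g x) j ≡ outNeighboursIn A orb x j
    outNeighboursIn-act g x j = trans (count-act g (λ y → A (act g x) y ∧ ⌊ orb y ≟ᶠ j ⌋))
      (count-cong (λ y → cong₂ (λ a l → a ∧ ⌊ l ≟ᶠ j ⌋) (act-aut g x y) (orb-act g y)))

    outNeighboursIn-sameOrbit : ∀ {x x′} → orb x ≡ orb x′ → ∀ j →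
      outNeighboursIn A orb x j ≡ outNeighboursIn A orb x′ j
    outNeighboursIn-sameOrbit {x} {x′} same j with Equivalence.to (sameOrbit x x′) same
    ... | g , refl = sym (outNeighboursIn-act g x j)

    sum-rowOrbitMatrix² : ∀ (rep : Fin b → Fin v) → (∀ i → orb (rep i) ≡ i) → ∀ i j →
      sum (λ s → rowOrbitMatrix A orb rep i s *ℕ rowOrbitMatrix A orb rep s j)
        ≡ sum (λ y → paths2 A (rep i) y *ℕ 𝟙 ⌊ orb y ≟ᶠ j ⌋)
    sum-rowOrbitMatrix² rep rep-orb i j = begin
      sum (λ s → r i s *ℕ r s j)
        ≡⟨ sum-outNeighboursIn A orb (rep i) (λ s → r s j) ⟩
      sum (λ z → 𝟙 (A (rep i) z) *ℕ r (orb z) j)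
        ≡⟨ sum-cong-≗ (λ z → cong (𝟙 (A (rep i) z) *ℕ_) (outNeighboursIn-sameOrbit (rep-orb (orb z)) j)) ⟩
      sum (λ z → 𝟙 (A (rep i) z) *ℕ outNeighboursIn A orb z j)
        ≡⟨ sum-outNeighboursIn≡sum-paths2 A orb (rep i) j ⟩
      sum (λ y → paths2 A (rep i) y *ℕ 𝟙 ⌊ orb y ≟ᶠ j ⌋) ∎
      where
      r : Fin b → Fin b → ℕ
      r = rowOrbitMatrix A orb rep

module _ {v k t lam mu : ℕ} {A : Digraph v} (dsrg : IsDSRG v k t lam mu A) where

  open IsDSRG dsrg using (noLoops; pathsSame; pathsArc; pathsNon)

  -- Entry (x, y) of A² + μI + μA = tI + λA + μJ, stated without subtraction.
  paths2-identity : ∀ x y →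
    paths2 A x y +ℕ 𝟙 ⌊ x ≟ᶠ y ⌋ *ℕ mu +ℕ 𝟙 (A x y) *ℕ mu ≡ 𝟙 ⌊ x ≟ᶠ y ⌋ *ℕ t +ℕ 𝟙 (A x y) *ℕ lam +ℕ mu
  paths2-identity x y with x ≟ᶠ y
  ... | yes refl rewrite pathsSame x | noLoops x = solve (t ∷ mu ∷ [])
  ... | no x≢y with A x y in arc
  ...   | true rewrite pathsArc x y x≢y arc = solve (lam ∷ mu ∷ [])
  ...   | false rewrite pathsNon x y x≢y arc = solve (mu ∷ [])

  paths2-column-identity : ∀ {b} (lab : Fin v → Fin b) x j →
    sum (λ y → paths2 A x y *ℕ 𝟙 ⌊ lab y ≟ᶠ j ⌋) +ℕ 𝟙 ⌊ lab x ≟ᶠ j ⌋ *ℕ mu +ℕ outNeighboursIn A lab x j *ℕ mu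
      ≡ 𝟙 ⌊ lab x ≟ᶠ j ⌋ *ℕ t +ℕ outNeighboursIn A lab x j *ℕ lam +ℕ orbitSize lab j *ℕ mu
  paths2-column-identity lab x j =
    substitute (sum-indicator x I) (sym (outNeighboursIn≡sum A lab x j)) (sym (count≡sum (λ y → ⌊ lab y ≟ᶠ j ⌋)))
    where
    I : Fin v → ℕ
    I y = 𝟙 ⌊ lab y ≟ᶠ j ⌋
    D a : Fin v → ℕ
    D y = 𝟙 ⌊ x ≟ᶠ y ⌋
    a y = 𝟙 (A x y)
    substitute : ∀ {d r n} → sum (λ y → D y *ℕ I y) ≡ d → sum (λ y → a y *ℕ I y) ≡ r → sum I ≡ n →
      sum (λ y → paths2 A x y *ℕ I y) +ℕ d *ℕ mu +ℕ r *ℕ mu ≡ d *ℕ t +ℕ r *ℕ lam +ℕ n *ℕ mu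
    substitute refl refl refl = sum-weighted-identity (paths2 A x) D a t lam mu (paths2-identity x) I

δ≡𝟙 : ∀ {n} (i j : Fin n) → δ i j ≡ + 𝟙 ⌊ i ≟ᶠ j ⌋
δ≡𝟙 i j with i ≟ᶠ j
... | yes _ = refl
... | no _ = refl

cancel-μ-terms : ∀ S d r n t lam mu → S +ℕ d *ℕ mu +ℕ r *ℕ mu ≡ d *ℕ t +ℕ r *ℕ lam +ℕ n *ℕ mu →
  + S ≡ + d * (+ t - + mu) + + r * + lam + (+ n - + r) * + mu
cancel-μ-terms S d r n t lam mu e = begin
  + S
    ≡⟨ isolate (+ S) (+ d) (+ r) (+ mu) ⟩
  (+ S + + d * + mu + + r * + mu) - (+ d * + mu + + r * + mu)
    ≡⟨ cong (_- (+ d * + mu + + r * + mu)) e-in-ℤ ⟩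
  (+ d * + t + + r * + lam + + n * + mu) - (+ d * + mu + + r * + mu)
    ≡⟨ rearrange (+ d) (+ r) (+ n) (+ t) (+ lam) (+ mu) ⟩
  + d * (+ t - + mu) + + r * + lam + (+ n - + r) * + mu ∎
  where
  isolate : ∀ S d r mu → S ≡ (S + d * mu + r * mu) - (d * mu + r * mu)
  isolate = ℤ-Solver.solve-∀
  rearrange : ∀ d r n t lam mu →
    (d * t + r * lam + n * mu) - (d * mu + r * mu) ≡ d * (t - mu) + r * lam + (n - r) * mu
  rearrange = ℤ-Solver.solve-∀
  e-in-ℤ : + S + + d * + mu + + r * + mu ≡ + d * + t + + r * + lam + + n * + mu
  e-in-ℤ = begin
    + S + + d * + mu + + r * + mu
      ≡⟨ sym (cong₂ (λ p q → + S + p + q) (ℤ.pos-* d mu) (ℤ.pos-* r mu)) ⟩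
    + (S +ℕ d *ℕ mu +ℕ r *ℕ mu)
      ≡⟨ cong +_ e ⟩
    + (d *ℕ t +ℕ r *ℕ lam +ℕ n *ℕ mu)
      ≡⟨ cong₂ _+_ (cong₂ _+_ (ℤ.pos-* d t) (ℤ.pos-* r lam)) (ℤ.pos-* n mu) ⟩
    + d * + t + + r * + lam + + n * + mu ∎

theorem1 : ∀ {c ℓ : Level} (v k t lam mu : ℕ) (A : Digraph v) → IsDSRG v k t lam mu A
    → (G : Group c ℓ) (act : Group.Carrier G → Fin v → Fin v) → IsAutAction A G act
    → (b : ℕ) (orb : Fin v → Fin b) → IsOrbitLabelling G act b orb
    → (rep : Fin b → Fin v) → (∀ i → orb (rep i) ≡ i)
    → (∀ i j → rowOrbitMatrix A orb rep i j ≤ orbitSize orb j)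
      × (∀ i → rowOrbitMatrix A orb rep i i ≤ orbitSize orb i ∸ 1)
      × (∀ i → ∑ (λ j → rowOrbitMatrix A orb rep i j) ≡ k)
      × (∀ i j → + ∑ (λ s → rowOrbitMatrix A orb rep i s *ℕ rowOrbitMatrix A orb rep s j)
                 ≡ δ i j * (+ t - + mu) + (+ rowOrbitMatrix A orb rep i j) * + lam
                   + (+ orbitSize orb j - + rowOrbitMatrix A orb rep i j) * + mu)
theorem1 v k t lam mu A dsrg G act aut b orb orbits rep rep-orb = bounded , diagonal , rowSum , square
  where
  open IsDSRG dsrg using (noLoops; outDegree)
  r : Fin b → Fin b → ℕ
  r = rowOrbitMatrix A orb rep

  bounded : ∀ i j → r i j ≤ orbitSize orb j
  bounded i = outNeighboursIn≤orbitSize A orb (rep i)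

  diagonal : ∀ i → r i i ≤ orbitSize orb i ∸ 1
  diagonal i with outNeighboursIn-<-orbitSize A orb (rep i) (noLoops (rep i))
  ... | r<n rewrite rep-orb i = subst (r i i ≤_) (ℕ.pred[m∸n]≡m∸[1+n] (orbitSize orb i) 0) (ℕ.<⇒≤pred r<n)

  rowSum : ∀ i → ∑ (r i) ≡ k
  rowSum i = trans (∑≡sum (r i)) (trans (sum-outNeighboursIn≡outDegree A orb (rep i)) (outDegree (rep i)))

  δ-rep : ∀ i j → δ i j ≡ + 𝟙 ⌊ orb (rep i) ≟ᶠ j ⌋
  δ-rep i j = trans (δ≡𝟙 i j) (cong (λ l → + 𝟙 ⌊ l ≟ᶠ j ⌋) (sym (rep-orb i)))

  square : ∀ i j → + ∑ (λ s → r i s *ℕ r s j)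
                   ≡ δ i j * (+ t - + mu) + (+ r i j) * + lam + (+ orbitSize orb j - + r i j) * + mu
  square i j rewrite δ-rep i j | ∑≡sum (λ s → r i s *ℕ r s j) | sum-rowOrbitMatrix² aut orbits rep rep-orb i j =
    cancel-μ-terms _ (𝟙 ⌊ orb (rep i) ≟ᶠ j ⌋) (r i j) (orbitSize orb j) t lam mu
      (paths2-column-identity dsrg orb (rep i) j)
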